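{- For $n\ge1$ let $\mathcal{H}_n=\{S\subseteq \mathbb{F}_2^n : \exists\, v\in\mathbb{F}_2^n \text{ with } v^\perp\subseteq S\}$. Then $|\mathcal{H}_n| = (1+o(1))\,2^{2^{n-1}}(2^n-1)$ as $n\to\infty$.
   Context: $v^\perp=\{x\in\mathbb{F}_2^n : \langle x,v\rangle=0\}$ with the standard bilinear form $\langle x,v\rangle=\sum_i x_iv_i$ over $\mathbb{F}_2$. -}

module Defs where

open import Data.Bool using (Bool; true; false; _∧_; _∨_; _xor_; not)
open import Data.Nat using (ℕ; zero; suc; _*_; _^_; _∸_)
open import Data.List using (List; []; _∷_; _++_; map; concatMap; length; filterᵇ)
open import Data.Bool.ListAction using (all; any)
open import Data.Vec using (Vec; []; _∷_; zipWith; foldr′)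

-- Vectors of 𝔽₂ⁿ, with 𝔽₂ = Bool (false = 0, true = 1; + is xor, · is ∧).
F₂^ : ℕ → Set
F₂^ n = Vec Bool n

⟨_,_⟩ : ∀ {n} → F₂^ n → F₂^ n → Bool
⟨ x , v ⟩ = foldr′ _xor_ false (zipWith _∧_ x v)

allVecs : (n : ℕ) → List (F₂^ n)
allVecs zero = [] ∷ []
allVecs (suc n) = map (false ∷_) (allVecs n) ++ map (true ∷_) (allVecs n)

SubsetF : ℕ → Set
SubsetF n = F₂^ n → Bool

glue : ∀ {n} → SubsetF n → SubsetF n → SubsetF (suc n)
glue S₀ S₁ (false ∷ v) = S₀ v
glue S₀ S₁ (true ∷ v) = S₁ v

allSubsets : (n : ℕ) → List (SubsetF n)
allSubsets zero = (λ _ → false) ∷ (λ _ → true) ∷ []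
allSubsets (suc n) = concatMap (λ S₀ → map (glue S₀) (allSubsets n)) (allSubsets n)

perp⊆ : ∀ {n} → F₂^ n → SubsetF n → Bool
perp⊆ {n} v S = all (λ x → ⟨ x , v ⟩ ∨ S x) (allVecs n)

inℋ : ∀ {n} → SubsetF n → Bool
inℋ {n} S = any (λ v → perp⊆ v S) (allVecs n)

card-ℋ : ℕ → ℕ
card-ℋ n = length (filterᵇ inℋ (allSubsets n))

mainTerm : ℕ → ℕ
mainTerm n = 2 ^ (2 ^ (n ∸ 1)) * (2 ^ n ∸ 1)

{-# OPTIONS --safe #-}
module Submission where

-- Write F_v = {S : v^⊥ ⊆ S}, so that ℋₙ is the union of the F_v. Since S ∈ F_v is free exactly
-- off v^⊥, |F_v| = 2^|𝔽₂ⁿ ∖ v^⊥|: this is 1 for v = 0 and 2^(2^(n-1)) for v ≠ 0, as v^⊥ is then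
-- a hyperplane. Hence the union bound gives |ℋₙ| ≤ (2ⁿ - 1)·2^(2^(n-1)) + 1. For u ≠ v the set
-- F_u ∩ F_v is free only off u^⊥ ∪ v^⊥, whose complement has at most 2^(n-2) points (exactly
-- 2^(n-2) when u, v, u + v ≠ 0, by inclusion–exclusion over the three hyperplanes), so Bonferroni's
-- inequality loses at most 4ⁿ·2^(2^(n-2)), negligible against 2^(2^(n-1)).

open import Defs
open import Algebra.Bundles using (CommutativeMonoid)
open import Data.Bool using (Bool; true; false; not; _∧_; _∨_; _xor_)
open import Data.Bool.Properties
  using ( ∧-commutativeMonoid; ∧-assoc; ∧-zeroʳ; ∧-distribˡ-∨; ∨-distribʳ-∧
        ; xor-assoc; xor-comm; xor-identityʳ; not-distribˡ-xor )
open import Data.Bool.ListAction using (all; any)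
open import Data.Bool.Solver using (module xor-∧-Solver)
open import Data.List using (List; []; _∷_; _++_; map; concatMap; length; filterᵇ)
open import Data.List.Properties using (length-++; length-map)
open import Data.List.Relation.Unary.All using (All; []; _∷_; universal)
import Data.List.Relation.Unary.All.Properties as All
open import Data.List.Relation.Unary.AllPairs using (AllPairs; []; _∷_)
import Data.List.Relation.Unary.AllPairs as AllPairs
import Data.List.Relation.Unary.AllPairs.Properties as AllPairsₚ
open import Data.Nat
  using (ℕ; zero; suc; _+_; _*_; _^_; _∸_; _≤_; _<_; _≤′_; ≤′-refl; ≤′-step; ∣_-_∣; z≤n; s≤s)
open import Data.Nat.Properties
open import Data.Nat.Solver using (module +-*-Solver)
open import Data.Product using (∃-syntax; _,_)
open import Data.Sum using (inj₁; inj₂)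
open import Data.Vec using ([]; _∷_; zipWith)
open import Data.Vec.Properties using (∷-injectiveʳ)
open import Function using (_∘_)
open import Relation.Binary.PropositionalEquality
open import Relation.Nullary using (contradiction)

open import Algebra.Properties.CommutativeSemigroup +-commutativeSemigroup
  using () renaming (interchange to +-interchange)
open import Algebra.Properties.CommutativeSemigroup
  (CommutativeMonoid.commutativeSemigroup ∧-commutativeMonoid)
  using () renaming (interchange to ∧-interchange)

private variable
  A B C : Set

sumBy : (A → ℕ) → List A → ℕ
sumBy f []       = 0
sumBy f (x ∷ xs) = f x + sumBy f xs

𝟙 : Bool → ℕ
𝟙 true  = 1
𝟙 false = 0

count : (A → Bool) → List A → ℕ
count p = sumBy (𝟙 ∘ p)

length-filterᵇ : (p : A → Bool) (xs : List A) → length (filterᵇ p xs) ≡ count p xs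
length-filterᵇ p []       = refl
length-filterᵇ p (x ∷ xs) with p x
... | true  = cong suc (length-filterᵇ p xs)
... | false = length-filterᵇ p xs

sumBy-cong : {f g : A → ℕ} (xs : List A) → (∀ x → f x ≡ g x) → sumBy f xs ≡ sumBy g xs
sumBy-cong []       f≗g = refl
sumBy-cong (x ∷ xs) f≗g = cong₂ _+_ (f≗g x) (sumBy-cong xs f≗g)

sumBy-mono : {f g : A → ℕ} (xs : List A) → (∀ x → f x ≤ g x) → sumBy f xs ≤ sumBy g xs
sumBy-mono []       f≤g = z≤n
sumBy-mono (x ∷ xs) f≤g = +-mono-≤ (f≤g x) (sumBy-mono xs f≤g)

sumBy-≤ : {f : A → ℕ} {b : ℕ} {xs : List A} → All (λ x → f x ≤ b) xs → sumBy f xs ≤ length xs * b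
sumBy-≤ []           = z≤n
sumBy-≤ (fx≤b ∷ f≤b) = +-mono-≤ fx≤b (sumBy-≤ f≤b)

sumBy-+ : (f g : A → ℕ) (xs : List A) → sumBy (λ x → f x + g x) xs ≡ sumBy f xs + sumBy g xs
sumBy-+ f g []       = refl
sumBy-+ f g (x ∷ xs) =
  trans (cong (f x + g x +_) (sumBy-+ f g xs)) (+-interchange (f x) (g x) (sumBy f xs) (sumBy g xs))

sumBy-*ˡ : (k : ℕ) (f : A → ℕ) (xs : List A) → sumBy (λ x → k * f x) xs ≡ k * sumBy f xs
sumBy-*ˡ k f []       = sym (*-zeroʳ k)
sumBy-*ˡ k f (x ∷ xs) =
  trans (cong (k * f x +_) (sumBy-*ˡ k f xs)) (sym (*-distribˡ-+ k (f x) (sumBy f xs)))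

sumBy-*ʳ : (f : A → ℕ) (k : ℕ) (xs : List A) → sumBy (λ x → f x * k) xs ≡ sumBy f xs * k
sumBy-*ʳ f k []       = refl
sumBy-*ʳ f k (x ∷ xs) =
  trans (cong (f x * k +_) (sumBy-*ʳ f k xs)) (sym (*-distribʳ-+ k (f x) (sumBy f xs)))

sumBy-++ : (f : A → ℕ) (xs ys : List A) → sumBy f (xs ++ ys) ≡ sumBy f xs + sumBy f ys
sumBy-++ f []       ys = refl
sumBy-++ f (x ∷ xs) ys =
  trans (cong (f x +_) (sumBy-++ f xs ys)) (sym (+-assoc (f x) (sumBy f xs) (sumBy f ys)))

sumBy-map : (f : B → ℕ) (g : A → B) (xs : List A) → sumBy f (map g xs) ≡ sumBy (f ∘ g) xs
sumBy-map f g []       = refl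
sumBy-map f g (x ∷ xs) = cong (f (g x) +_) (sumBy-map f g xs)

sumBy-concatMap : (f : B → ℕ) (g : A → List B) (xs : List A) →
                  sumBy f (concatMap g xs) ≡ sumBy (sumBy f ∘ g) xs
sumBy-concatMap f g []       = refl
sumBy-concatMap f g (x ∷ xs) =
  trans (sumBy-++ f (g x) (concatMap g xs)) (cong (sumBy f (g x) +_) (sumBy-concatMap f g xs))

sumBy-+-cong : {f g h k : A → ℕ} (xs : List A) → (∀ x → f x + g x ≡ h x + k x) →
               sumBy f xs + sumBy g xs ≡ sumBy h xs + sumBy k xs
sumBy-+-cong {f = f} {g} {h} {k} xs eq =
  trans (sym (sumBy-+ f g xs)) (trans (sumBy-cong xs eq) (sumBy-+ h k xs))

𝟙-∧ : ∀ a b → 𝟙 (a ∧ b) ≡ 𝟙 a * 𝟙 b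
𝟙-∧ true  b = sym (+-identityʳ (𝟙 b))
𝟙-∧ false b = refl

𝟙-∧≤ˡ : ∀ a b → 𝟙 (a ∧ b) ≤ 𝟙 a
𝟙-∧≤ˡ true  true  = ≤-refl
𝟙-∧≤ˡ true  false = z≤n
𝟙-∧≤ˡ false b     = ≤-refl

𝟙-∧≤ʳ : ∀ a b → 𝟙 (a ∧ b) ≤ 𝟙 b
𝟙-∧≤ʳ true  b = ≤-refl
𝟙-∧≤ʳ false b = z≤n

𝟙-not : ∀ a → 𝟙 a + 𝟙 (not a) ≡ 1
𝟙-not true  = refl
𝟙-not false = refl

𝟙-∨-∧ : ∀ a b → 𝟙 (a ∨ b) + 𝟙 (a ∧ b) ≡ 𝟙 a + 𝟙 b
𝟙-∨-∧ true  true  = refl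
𝟙-∨-∧ true  false = refl
𝟙-∨-∧ false true  = refl
𝟙-∨-∧ false false = refl

𝟙-∧-xor : ∀ a b → 2 * 𝟙 (a ∧ b) + 𝟙 (a xor b) ≡ 𝟙 a + 𝟙 b
𝟙-∧-xor true  true  = refl
𝟙-∧-xor true  false = refl
𝟙-∧-xor false true  = refl
𝟙-∧-xor false false = refl

count-cong : {p q : A → Bool} (xs : List A) → (∀ x → p x ≡ q x) → count p xs ≡ count q xs
count-cong xs p≗q = sumBy-cong xs (cong 𝟙 ∘ p≗q)

count-false : (xs : List A) → count (λ _ → false) xs ≡ 0
count-false []       = refl
count-false (x ∷ xs) = count-false xs

count-true : (xs : List A) → count (λ _ → true) xs ≡ length xs
count-true []       = refl
count-true (x ∷ xs) = cong suc (count-true xs)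

count-not : (p : A → Bool) (xs : List A) → count p xs + count (not ∘ p) xs ≡ length xs
count-not p xs = trans (sym (sumBy-+ _ _ xs)) (trans (sumBy-cong xs (𝟙-not ∘ p)) (count-true xs))

count-∨-∧ : (p q : A → Bool) (xs : List A) →
            count (λ x → p x ∨ q x) xs + count (λ x → p x ∧ q x) xs ≡ count p xs + count q xs
count-∨-∧ p q xs = sumBy-+-cong xs (λ x → 𝟙-∨-∧ (p x) (q x))

count-∧-xor : (p q : A → Bool) (xs : List A) →
              2 * count (λ x → p x ∧ q x) xs + count (λ x → p x xor q x) xs ≡ count p xs + count q xs
count-∧-xor p q xs = trans (cong (_+ count (λ x → p x xor q x) xs) (sym (sumBy-*ˡ 2 _ xs)))
                           (sumBy-+-cong xs (λ x → 𝟙-∧-xor (p x) (q x)))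

count-∧≤ˡ : (p q : A → Bool) (xs : List A) → count (λ x → p x ∧ q x) xs ≤ count p xs
count-∧≤ˡ p q xs = sumBy-mono xs (λ x → 𝟙-∧≤ˡ (p x) (q x))

count-∧≤ʳ : (p q : A → Bool) (xs : List A) → count (λ x → p x ∧ q x) xs ≤ count q xs
count-∧≤ʳ p q xs = sumBy-mono xs (λ x → 𝟙-∧≤ʳ (p x) (q x))

count-product : (r : C → Bool) (g : A → B → C) (p : A → Bool) (q : B → Bool) →
                (∀ a b → r (g a b) ≡ (p a ∧ q b)) → (xs : List A) (ys : List B) →
                count r (concatMap (λ a → map (g a) ys) xs) ≡ count p xs * count q ys
count-product r g p q r≡p∧q xs ys = begin
    count r (concatMap (λ a → map (g a) ys) xs) ≡⟨ sumBy-concatMap (𝟙 ∘ r) _ xs ⟩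
    sumBy (λ a → count r (map (g a) ys)) xs     ≡⟨ sumBy-cong xs row ⟩
    sumBy (λ a → 𝟙 (p a) * count q ys) xs       ≡⟨ sumBy-*ʳ (𝟙 ∘ p) (count q ys) xs ⟩
    count p xs * count q ys                     ∎
  where
  open ≡-Reasoning
  row : ∀ a → count r (map (g a) ys) ≡ 𝟙 (p a) * count q ys
  row a = begin
    count r (map (g a) ys)            ≡⟨ sumBy-map (𝟙 ∘ r) (g a) ys ⟩
    sumBy (λ b → 𝟙 (r (g a b))) ys    ≡⟨ sumBy-cong ys (λ b → trans (cong 𝟙 (r≡p∧q a b)) (𝟙-∧ (p a) (q b))) ⟩
    sumBy (λ b → 𝟙 (p a) * 𝟙 (q b)) ys ≡⟨ sumBy-*ˡ (𝟙 (p a)) (𝟙 ∘ q) ys ⟩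
    𝟙 (p a) * count q ys              ∎

∧-distribˡ-any : (a : Bool) (q : A → Bool) (xs : List A) → (a ∧ any q xs) ≡ any (λ x → a ∧ q x) xs
∧-distribˡ-any a q []       = ∧-zeroʳ a
∧-distribˡ-any a q (x ∷ xs) =
  trans (∧-distribˡ-∨ a (q x) (any q xs)) (cong ((a ∧ q x) ∨_) (∧-distribˡ-any a q xs))

count-any≤sumBy-count : {V X : Set} (P : V → X → Bool) (xs : List X) (vs : List V) →
                        count (λ x → any (λ v → P v x) vs) xs ≤ sumBy (λ v → count (P v) xs) vs
count-any≤sumBy-count P xs []       = ≤-reflexive (count-false xs)
count-any≤sumBy-count {X = X} P xs (v ∷ vs) = begin
    count (λ x → P v x ∨ U x) xs
  ≤⟨ m≤m+n _ _ ⟩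
    count (λ x → P v x ∨ U x) xs + count (λ x → P v x ∧ U x) xs
  ≡⟨ count-∨-∧ (P v) U xs ⟩
    count (P v) xs + count U xs
  ≤⟨ +-monoʳ-≤ (count (P v) xs) (count-any≤sumBy-count P xs vs) ⟩
    count (P v) xs + sumBy (λ u → count (P u) xs) vs
  ∎
  where
  open ≤-Reasoning
  U : X → Bool
  U x = any (λ u → P u x) vs

module _ {V X : Set} (P : V → X → Bool) (xs : List X) where

  overlapCount : V → V → ℕ
  overlapCount v u = count (λ x → P v x ∧ P u x) xs

  pairwiseOverlap : List V → ℕ
  pairwiseOverlap []       = 0
  pairwiseOverlap (v ∷ vs) = sumBy (overlapCount v) vs + pairwiseOverlap vs

  sumBy-count≤count-any+pairwiseOverlap : (vs : List V) →
    sumBy (λ v → count (P v) xs) vs ≤ count (λ x → any (λ v → P v x) vs) xs + pairwiseOverlap vs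
  sumBy-count≤count-any+pairwiseOverlap []       = z≤n
  sumBy-count≤count-any+pairwiseOverlap (v ∷ vs) = begin
      count (P v) xs + sumBy (λ u → count (P u) xs) vs
    ≤⟨ +-monoʳ-≤ (count (P v) xs) (sumBy-count≤count-any+pairwiseOverlap vs) ⟩
      count (P v) xs + (count U xs + pairwiseOverlap vs)
    ≡⟨ +-assoc (count (P v) xs) _ _ ⟨
      count (P v) xs + count U xs + pairwiseOverlap vs
    ≡⟨ cong (_+ pairwiseOverlap vs) (count-∨-∧ (P v) U xs) ⟨
      count (λ x → P v x ∨ U x) xs + count (λ x → P v x ∧ U x) xs + pairwiseOverlap vs
    ≤⟨ +-monoˡ-≤ (pairwiseOverlap vs) (+-monoʳ-≤ (count (λ x → P v x ∨ U x) xs) overlap-bound) ⟩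
      count (λ x → P v x ∨ U x) xs + sumBy (overlapCount v) vs + pairwiseOverlap vs
    ≡⟨ +-assoc (count (λ x → P v x ∨ U x) xs) _ _ ⟩
      count (λ x → P v x ∨ U x) xs + (sumBy (overlapCount v) vs + pairwiseOverlap vs)
    ∎
    where
    open ≤-Reasoning
    U : X → Bool
    U x = any (λ u → P u x) vs
    overlap-bound : count (λ x → P v x ∧ U x) xs ≤ sumBy (overlapCount v) vs
    overlap-bound = begin
        count (λ x → P v x ∧ U x) xs
      ≡⟨ count-cong xs (λ x → ∧-distribˡ-any (P v x) (λ u → P u x) vs) ⟩
        count (λ x → any (λ u → P v x ∧ P u x) vs) xs
      ≤⟨ count-any≤sumBy-count (λ u x → P v x ∧ P u x) xs vs ⟩
        sumBy (overlapCount v) vs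
      ∎

  pairwiseOverlap≤ : {b : ℕ} {vs : List V} → AllPairs (λ v u → overlapCount v u ≤ b) vs →
                     pairwiseOverlap vs ≤ length vs * length vs * b
  pairwiseOverlap≤              []                  = z≤n
  pairwiseOverlap≤ {b} {v ∷ vs} (v-overlaps ∷ rest) = begin
      sumBy (overlapCount v) vs + pairwiseOverlap vs ≤⟨ +-mono-≤ (sumBy-≤ v-overlaps) (pairwiseOverlap≤ rest) ⟩
      l * b + l * l * b                         ≤⟨ m≤m+n _ (b + l * b) ⟩
      l * b + l * l * b + (b + l * b)           ≡⟨ solve 2 (λ l b → l :* b :+ l :* l :* b :+ (b :+ l :* b)
                                                                 := (con 1 :+ l) :* (con 1 :+ l) :* b) refl l b ⟩
      suc l * suc l * b                         ∎
    where
    open ≤-Reasoning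
    open +-*-Solver
    l : ℕ
    l = length vs

all-cong : {p q : A → Bool} (xs : List A) → (∀ x → p x ≡ q x) → all p xs ≡ all q xs
all-cong []       p≗q = refl
all-cong (x ∷ xs) p≗q = cong₂ _∧_ (p≗q x) (all-cong xs p≗q)

all-∧ : (p q : A → Bool) (xs : List A) → (all p xs ∧ all q xs) ≡ all (λ x → p x ∧ q x) xs
all-∧ p q []       = refl
all-∧ p q (x ∷ xs) =
  trans (∧-interchange (p x) (all p xs) (q x) (all q xs)) (cong ((p x ∧ q x) ∧_) (all-∧ p q xs))

all-++ : (p : A → Bool) (xs ys : List A) → all p (xs ++ ys) ≡ (all p xs ∧ all p ys)
all-++ p []       ys = refl
all-++ p (x ∷ xs) ys = trans (cong (p x ∧_) (all-++ p xs ys)) (sym (∧-assoc (p x) (all p xs) (all p ys)))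

all-map : (p : B → Bool) (g : A → B) (xs : List A) → all p (map g xs) ≡ all (p ∘ g) xs
all-map p g []       = refl
all-map p g (x ∷ xs) = cong (p (g x) ∧_) (all-map p g xs)

length-allVecs : ∀ n → length (allVecs n) ≡ 2 ^ n
length-allVecs zero    = refl
length-allVecs (suc n) = begin
    length (map (false ∷_) V ++ map (true ∷_) V)       ≡⟨ length-++ (map (false ∷_) V) ⟩
    length (map (false ∷_) V) + length (map (true ∷_) V) ≡⟨ cong₂ _+_ (length-map _ V) (length-map _ V) ⟩
    length V + length V                                 ≡⟨ cong₂ _+_ (length-allVecs n) (length-allVecs n) ⟩
    2 ^ n + 2 ^ n                                       ≡⟨ cong (2 ^ n +_) (+-identityʳ (2 ^ n)) ⟨
    2 ^ suc n                                           ∎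
  where
  open ≡-Reasoning
  V : List (F₂^ n)
  V = allVecs n

allVecs-distinct : ∀ n → AllPairs _≢_ (allVecs n)
allVecs-distinct zero    = [] ∷ []
allVecs-distinct (suc n) = AllPairsₚ.++⁺ (with-head false) (with-head true) heads-differ
  where
  V : List (F₂^ n)
  V = allVecs n
  with-head : ∀ b → AllPairs _≢_ (map (b ∷_) V)
  with-head b = AllPairsₚ.map⁺ (AllPairs.map (λ u≢v → u≢v ∘ ∷-injectiveʳ) (allVecs-distinct n))
  heads-differ : All (λ u → All (u ≢_) (map (true ∷_) V)) (map (false ∷_) V)
  heads-differ = All.map⁺ (universal (λ _ → All.map⁺ (universal (λ _ ()) V)) V)

sumBy-allVecs-suc : ∀ n (f : F₂^ (suc n) → ℕ) →
                    sumBy f (allVecs (suc n))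
                    ≡ sumBy (f ∘ (false ∷_)) (allVecs n) + sumBy (f ∘ (true ∷_)) (allVecs n)
sumBy-allVecs-suc n f =
  trans (sumBy-++ f (map (false ∷_) V) (map (true ∷_) V)) (cong₂ _+_ (sumBy-map f _ V) (sumBy-map f _ V))
  where
    V : List (F₂^ n)
    V = allVecs n

all-allVecs-suc : ∀ n (p : F₂^ (suc n) → Bool) →
                  all p (allVecs (suc n))
                  ≡ (all (p ∘ (false ∷_)) (allVecs n) ∧ all (p ∘ (true ∷_)) (allVecs n))
all-allVecs-suc n p =
  trans (all-++ p (map (false ∷_) V) (map (true ∷_) V)) (cong₂ _∧_ (all-map p _ V) (all-map p _ V))
  where
    V : List (F₂^ n)
    V = allVecs n

zeros⊆ : ∀ {n} → (F₂^ n → Bool) → SubsetF n → Bool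
zeros⊆ {n} f S = all (λ x → f x ∨ S x) (allVecs n)

zeros⊆-∧ : ∀ {n} (f g : F₂^ n → Bool) (S : SubsetF n) →
           (zeros⊆ f S ∧ zeros⊆ g S) ≡ zeros⊆ (λ x → f x ∧ g x) S
zeros⊆-∧ {n} f g S =
  trans (all-∧ _ _ (allVecs n)) (all-cong (allVecs n) (λ x → sym (∨-distribʳ-∧ (S x) (f x) (g x))))

count-zeros⊆ : ∀ n (f : F₂^ n → Bool) → count (zeros⊆ f) (allSubsets n) ≡ 2 ^ count f (allVecs n)
count-zeros⊆ zero    f with f []
... | true  = refl
... | false = refl
count-zeros⊆ (suc n) f = begin
    count (zeros⊆ f) (allSubsets (suc n))
  ≡⟨ count-product (zeros⊆ f) glue (zeros⊆ f₀) (zeros⊆ f₁) (λ S₀ S₁ → all-allVecs-suc n _) Subs Subs ⟩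
    count (zeros⊆ f₀) Subs * count (zeros⊆ f₁) Subs
  ≡⟨ cong₂ _*_ (count-zeros⊆ n f₀) (count-zeros⊆ n f₁) ⟩
    2 ^ count f₀ V * 2 ^ count f₁ V
  ≡⟨ ^-distribˡ-+-* 2 (count f₀ V) (count f₁ V) ⟨
    2 ^ (count f₀ V + count f₁ V)
  ≡⟨ cong (2 ^_) (sumBy-allVecs-suc n (𝟙 ∘ f)) ⟨
    2 ^ count f (allVecs (suc n))
  ∎
  where
  open ≡-Reasoning
  V : List (F₂^ n)
  V = allVecs n
  Subs : List (SubsetF n)
  Subs = allSubsets n
  f₀ f₁ : F₂^ n → Bool
  f₀ = f ∘ (false ∷_)
  f₁ = f ∘ (true ∷_)

nonzero : ∀ {n} → F₂^ n → Bool
nonzero []      = false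
nonzero (b ∷ v) = b ∨ nonzero v

_+ᵥ_ : ∀ {n} → F₂^ n → F₂^ n → F₂^ n
_+ᵥ_ = zipWith _xor_

+ᵥ-zero⇒≡ : ∀ {n} (u v : F₂^ n) → nonzero (u +ᵥ v) ≡ false → u ≡ v
+ᵥ-zero⇒≡ []          []          _  = refl
+ᵥ-zero⇒≡ (false ∷ u) (false ∷ v) eq = cong (false ∷_) (+ᵥ-zero⇒≡ u v eq)
+ᵥ-zero⇒≡ (true  ∷ u) (true  ∷ v) eq = cong (true ∷_) (+ᵥ-zero⇒≡ u v eq)
+ᵥ-zero⇒≡ (false ∷ u) (true  ∷ v) ()
+ᵥ-zero⇒≡ (true  ∷ u) (false ∷ v) ()

⟨⟩-zeroʳ : ∀ {n} (x v : F₂^ n) → nonzero v ≡ false → ⟨ x , v ⟩ ≡ false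
⟨⟩-zeroʳ []      []          _   = refl
⟨⟩-zeroʳ (a ∷ x) (false ∷ v) v≡0 =
  trans (cong ((a ∧ false) xor_) (⟨⟩-zeroʳ x v v≡0)) (trans (xor-identityʳ _) (∧-zeroʳ a))

⟨⟩-linearʳ : ∀ {n} (x u v : F₂^ n) → (⟨ x , u ⟩ xor ⟨ x , v ⟩) ≡ ⟨ x , u +ᵥ v ⟩
⟨⟩-linearʳ []      []      []      = refl
⟨⟩-linearʳ (a ∷ x) (b ∷ u) (c ∷ v) =
  trans (rearrange a b c ⟨ x , u ⟩ ⟨ x , v ⟩) (cong ((a ∧ (b xor c)) xor_) (⟨⟩-linearʳ x u v))
  where
  open xor-∧-Solver
  rearrange : ∀ a b c r s → (((a ∧ b) xor r) xor ((a ∧ c) xor s)) ≡ ((a ∧ (b xor c)) xor (r xor s))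
  rearrange = solve 5 (λ a b c r s → ((a :* b) :+ r) :+ ((a :* c) :+ s)
                                   := (a :* (b :+ c)) :+ (r :+ s)) refl

count-⟨⟩-zero : ∀ n (v : F₂^ n) → nonzero v ≡ false → count (λ x → ⟨ x , v ⟩) (allVecs n) ≡ 0
count-⟨⟩-zero n v v≡0 =
  trans (count-cong (allVecs n) (λ x → ⟨⟩-zeroʳ x v v≡0)) (count-false (allVecs n))

count-xor-⟨⟩-∷ : ∀ {n} (α b : Bool) (v : F₂^ n) →
                 count (λ x → α xor ⟨ x , b ∷ v ⟩) (allVecs (suc n))
                 ≡ count (λ x → α xor ⟨ x , v ⟩) (allVecs n)
                   + count (λ x → (α xor b) xor ⟨ x , v ⟩) (allVecs n)
count-xor-⟨⟩-∷ {n} α b v = trans (sumBy-allVecs-suc n _)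
  (cong (_ +_) (count-cong (allVecs n) (λ x → sym (xor-assoc α b ⟨ x , v ⟩))))

count-xor-⟨⟩ : ∀ n (α : Bool) (v : F₂^ n) → nonzero v ≡ true →
               2 * count (λ x → α xor ⟨ x , v ⟩) (allVecs n) ≡ 2 ^ n
count-xor-⟨⟩ (suc n) α (b ∷ v) b∷v≢0 with nonzero v in v≢0
... | true = begin
    2 * count (λ x → α xor ⟨ x , b ∷ v ⟩) (allVecs (suc n))
  ≡⟨ cong (2 *_) (count-xor-⟨⟩-∷ α b v) ⟩
    2 * (c α + c (α xor b))
  ≡⟨ *-distribˡ-+ 2 (c α) (c (α xor b)) ⟩
    2 * c α + 2 * c (α xor b)
  ≡⟨ cong₂ _+_ (count-xor-⟨⟩ n α v v≢0) (count-xor-⟨⟩ n (α xor b) v v≢0) ⟩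
    2 ^ n + 2 ^ n
  ≡⟨ cong (2 ^ n +_) (+-identityʳ (2 ^ n)) ⟨
    2 ^ suc n
  ∎
  where
  open ≡-Reasoning
  c : Bool → ℕ
  c β = count (λ x → β xor ⟨ x , v ⟩) (allVecs n)
count-xor-⟨⟩ (suc n) α (true ∷ v) _ | false = begin
    2 * count (λ x → α xor ⟨ x , true ∷ v ⟩) (allVecs (suc n))
  ≡⟨ cong (2 *_) (count-xor-⟨⟩-∷ α true v) ⟩
    2 * (count p V + count (λ x → (α xor true) xor ⟨ x , v ⟩) V)
  ≡⟨ cong (λ β → 2 * (count p V + count (λ x → β xor ⟨ x , v ⟩) V)) (xor-comm α true) ⟩
    2 * (count p V + count (λ x → not α xor ⟨ x , v ⟩) V)
  ≡⟨ cong (λ m → 2 * (count p V + m)) (count-cong V (λ x → not-distribˡ-xor α ⟨ x , v ⟩)) ⟨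
    2 * (count p V + count (not ∘ p) V)
  ≡⟨ cong (2 *_) (trans (count-not p V) (length-allVecs n)) ⟩
    2 ^ suc n
  ∎
  where
  open ≡-Reasoning
  V : List (F₂^ n)
  V = allVecs n
  p : F₂^ n → Bool
  p x = α xor ⟨ x , v ⟩

count-⟨⟩∧⟨⟩ : ∀ n (u v : F₂^ n) → nonzero u ≡ true → nonzero v ≡ true → nonzero (u +ᵥ v) ≡ true →
              4 * count (λ x → ⟨ x , u ⟩ ∧ ⟨ x , v ⟩) (allVecs n) ≡ 2 ^ n
count-⟨⟩∧⟨⟩ n u v u≢0 v≢0 u+v≢0 = +-cancelʳ-≡ (2 ^ n) _ _ (begin
    4 * c + 2 ^ n       ≡⟨ cong₂ _+_ (*-assoc 2 2 c) (sym 2d≡2ⁿ) ⟩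
    2 * (2 * c) + 2 * d ≡⟨ *-distribˡ-+ 2 (2 * c) d ⟨
    2 * (2 * c + d)     ≡⟨ cong (2 *_) (count-∧-xor _ _ V) ⟩
    2 * (a + b)         ≡⟨ *-distribˡ-+ 2 a b ⟩
    2 * a + 2 * b       ≡⟨ cong₂ _+_ (count-xor-⟨⟩ n false u u≢0) (count-xor-⟨⟩ n false v v≢0) ⟩
    2 ^ n + 2 ^ n       ∎)
  where
  open ≡-Reasoning
  V : List (F₂^ n)
  V = allVecs n
  a b c d : ℕ
  a = count (λ x → ⟨ x , u ⟩) V
  b = count (λ x → ⟨ x , v ⟩) V
  c = count (λ x → ⟨ x , u ⟩ ∧ ⟨ x , v ⟩) V
  d = count (λ x → ⟨ x , u ⟩ xor ⟨ x , v ⟩) V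
  2d≡2ⁿ : 2 * d ≡ 2 ^ n
  2d≡2ⁿ = trans (cong (2 *_) (count-cong V (λ x → ⟨⟩-linearʳ x u v)))
                (count-xor-⟨⟩ n false (u +ᵥ v) u+v≢0)

count-⟨⟩∧⟨⟩≤ : ∀ n (u v : F₂^ n) → u ≢ v →
               4 * count (λ x → ⟨ x , u ⟩ ∧ ⟨ x , v ⟩) (allVecs n) ≤ 2 ^ n
count-⟨⟩∧⟨⟩≤ n u v u≢v with nonzero u in nz-u | nonzero v in nz-v | nonzero (u +ᵥ v) in nz-u+v
... | false | _     | _     =
  ≤-trans (*-monoʳ-≤ 4 (≤-trans (count-∧≤ˡ _ _ (allVecs n)) (≤-reflexive (count-⟨⟩-zero n u nz-u)))) z≤n
... | true  | false | _     =
  ≤-trans (*-monoʳ-≤ 4 (≤-trans (count-∧≤ʳ _ _ (allVecs n)) (≤-reflexive (count-⟨⟩-zero n v nz-v)))) z≤n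
... | true  | true  | false = contradiction (+ᵥ-zero⇒≡ u v nz-u+v) u≢v
... | true  | true  | true  = ≤-reflexive (count-⟨⟩∧⟨⟩ n u v nz-u nz-v nz-u+v)

count-not-nonzero : ∀ n → count (not ∘ nonzero) (allVecs n) ≡ 1
count-not-nonzero zero    = refl
count-not-nonzero (suc n) =
  trans (sumBy-allVecs-suc n _) (cong₂ _+_ (count-not-nonzero n) (count-false (allVecs n)))

count-nonzero : ∀ n → count nonzero (allVecs n) ≡ 2 ^ n ∸ 1
count-nonzero n = begin
    count nonzero V                               ≡⟨ m+n∸n≡m (count nonzero V) 1 ⟨
    count nonzero V + 1 ∸ 1                       ≡⟨ cong (λ m → count nonzero V + m ∸ 1) (count-not-nonzero n) ⟨
    count nonzero V + count (not ∘ nonzero) V ∸ 1 ≡⟨ cong (_∸ 1) (count-not nonzero V) ⟩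
    length V ∸ 1                                  ≡⟨ cong (_∸ 1) (length-allVecs n) ⟩
    2 ^ n ∸ 1                                     ∎
  where
  open ≡-Reasoning
  V : List (F₂^ n)
  V = allVecs n

-- perp⊆ v is definitionally zeros⊆ (λ x → ⟨ x , v ⟩).
count-perp⊆ : ∀ n (v : F₂^ (suc n)) →
              count (perp⊆ v) (allSubsets (suc n)) ≡ 2 ^ 2 ^ n * 𝟙 (nonzero v) + 𝟙 (not (nonzero v))
count-perp⊆ n v = trans (count-zeros⊆ (suc n) (λ x → ⟨ x , v ⟩)) (by-support (nonzero v) refl)
  where
  a : ℕ
  a = count (λ x → ⟨ x , v ⟩) (allVecs (suc n))
  by-support : ∀ t → nonzero v ≡ t → 2 ^ a ≡ 2 ^ 2 ^ n * 𝟙 t + 𝟙 (not t)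
  by-support true  v≢0 = trans (cong (2 ^_) (*-cancelˡ-≡ a (2 ^ n) 2 (count-xor-⟨⟩ (suc n) false v v≢0)))
                               (sym (trans (+-identityʳ _) (*-identityʳ _)))
  by-support false v≡0 = trans (cong (2 ^_) (count-⟨⟩-zero (suc n) v v≡0))
                               (cong (_+ 1) (sym (*-zeroʳ (2 ^ 2 ^ n))))

sumBy-count-perp⊆ : ∀ n →
                    sumBy (λ v → count (perp⊆ v) (allSubsets (suc n))) (allVecs (suc n)) ≡ mainTerm (suc n) + 1
sumBy-count-perp⊆ n = begin
    sumBy (λ v → count (perp⊆ v) (allSubsets (suc n))) V
  ≡⟨ sumBy-cong V (count-perp⊆ n) ⟩
    sumBy (λ v → 2 ^ 2 ^ n * 𝟙 (nonzero v) + 𝟙 (not (nonzero v))) V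
  ≡⟨ sumBy-+ _ _ V ⟩
    sumBy (λ v → 2 ^ 2 ^ n * 𝟙 (nonzero v)) V + count (not ∘ nonzero) V
  ≡⟨ cong (_+ count (not ∘ nonzero) V) (sumBy-*ˡ (2 ^ 2 ^ n) _ V) ⟩
    2 ^ 2 ^ n * count nonzero V + count (not ∘ nonzero) V
  ≡⟨ cong₂ (λ c c′ → 2 ^ 2 ^ n * c + c′) (count-nonzero (suc n)) (count-not-nonzero (suc n)) ⟩
    mainTerm (suc n) + 1
  ∎
  where
  open ≡-Reasoning
  V : List (F₂^ (suc n))
  V = allVecs (suc n)

card-ℋ-upper : ∀ n → card-ℋ (suc n) ≤ mainTerm (suc n) + 1
card-ℋ-upper n = begin
    card-ℋ (suc n)                                       ≡⟨ length-filterᵇ inℋ Subs ⟩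
    count inℋ Subs                                       ≤⟨ count-any≤sumBy-count perp⊆ Subs (allVecs (suc n)) ⟩
    sumBy (λ v → count (perp⊆ v) Subs) (allVecs (suc n)) ≡⟨ sumBy-count-perp⊆ n ⟩
    mainTerm (suc n) + 1                                 ∎
  where
  open ≤-Reasoning
  Subs : List (SubsetF (suc n))
  Subs = allSubsets (suc n)

count-perp⊆∧perp⊆≤ : ∀ m (u v : F₂^ (2 + m)) → u ≢ v →
                     count (λ S → perp⊆ u S ∧ perp⊆ v S) (allSubsets (2 + m)) ≤ 2 ^ 2 ^ m
count-perp⊆∧perp⊆≤ m u v u≢v = begin
    count (λ S → perp⊆ u S ∧ perp⊆ v S) (allSubsets (2 + m))
  ≡⟨ count-cong (allSubsets (2 + m)) (zeros⊆-∧ (λ x → ⟨ x , u ⟩) (λ x → ⟨ x , v ⟩)) ⟩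
    count (zeros⊆ (λ x → ⟨ x , u ⟩ ∧ ⟨ x , v ⟩)) (allSubsets (2 + m))
  ≡⟨ count-zeros⊆ (2 + m) _ ⟩
    2 ^ count (λ x → ⟨ x , u ⟩ ∧ ⟨ x , v ⟩) (allVecs (2 + m))
  ≤⟨ ^-monoʳ-≤ 2 quarter ⟩
    2 ^ 2 ^ m
  ∎
  where
  open ≤-Reasoning
  c : ℕ
  c = count (λ x → ⟨ x , u ⟩ ∧ ⟨ x , v ⟩) (allVecs (2 + m))
  quarter : c ≤ 2 ^ m
  quarter = *-cancelˡ-≤ 4 (subst (4 * c ≤_) (sym (*-assoc 2 2 (2 ^ m))) (count-⟨⟩∧⟨⟩≤ (2 + m) u v u≢v))

bonferroniError : ℕ → ℕ
bonferroniError m = 2 ^ (2 + m) * 2 ^ (2 + m) * 2 ^ 2 ^ m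

card-ℋ-lower : ∀ m → mainTerm (2 + m) ≤ card-ℋ (2 + m) + bonferroniError m
card-ℋ-lower m = begin
    mainTerm (2 + m)                              ≤⟨ m≤m+n _ 1 ⟩
    mainTerm (2 + m) + 1                          ≡⟨ sumBy-count-perp⊆ (suc m) ⟨
    sumBy (λ v → count (perp⊆ v) Subs) V          ≤⟨ sumBy-count≤count-any+pairwiseOverlap perp⊆ Subs V ⟩
    count inℋ Subs + pairwiseOverlap perp⊆ Subs V ≡⟨ cong (_+ pairwiseOverlap perp⊆ Subs V) (length-filterᵇ inℋ Subs) ⟨
    card-ℋ (2 + m) + pairwiseOverlap perp⊆ Subs V ≤⟨ +-monoʳ-≤ (card-ℋ (2 + m)) overlaps ⟩
    card-ℋ (2 + m) + bonferroniError m            ∎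
  where
  open ≤-Reasoning
  V : List (F₂^ (2 + m))
  V = allVecs (2 + m)
  Subs : List (SubsetF (2 + m))
  Subs = allSubsets (2 + m)
  overlaps : pairwiseOverlap perp⊆ Subs V ≤ bonferroniError m
  overlaps = subst (λ l → pairwiseOverlap perp⊆ Subs V ≤ l * l * 2 ^ 2 ^ m) (length-allVecs (2 + m))
                   (pairwiseOverlap≤ perp⊆ Subs
                     (AllPairs.map (count-perp⊆∧perp⊆≤ m _ _) (allVecs-distinct (2 + m))))

n<2^n : ∀ n → n < 2 ^ n
n<2^n zero    = s≤s z≤n
n<2^n (suc n) = +-mono-≤ (m^n>0 2 n) (≤-trans (n<2^n n) (m≤m+n (2 ^ n) 0))

4*n≤2^n : ∀ {n} → 4 ≤′ n → 4 * n ≤ 2 ^ n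
4*n≤2^n ≤′-refl                 = ≤-refl
4*n≤2^n {suc n} (≤′-step 4≤′n) = begin
    4 * suc n     ≡⟨ *-suc 4 n ⟩
    4 + 4 * n     ≤⟨ +-mono-≤ (≤-trans (≤′⇒≤ 4≤′n) (m≤m+n n _)) (4*n≤2^n 4≤′n) ⟩
    4 * n + 2 ^ n ≤⟨ +-monoˡ-≤ (2 ^ n) (4*n≤2^n 4≤′n) ⟩
    2 ^ n + 2 ^ n ≡⟨ cong (2 ^ n +_) (+-identityʳ (2 ^ n)) ⟨
    2 ^ suc n     ∎
  where open ≤-Reasoning

bonferroniError-negligible : ∀ k m → 5 + k ≤ m → suc k * (bonferroniError m + 1) ≤ mainTerm (2 + m)
bonferroniError-negligible k m 5+k≤m = begin
    suc k * (bonferroniError m + 1)  ≡⟨ cong (λ e → suc k * (e + 1)) error≡2^X ⟩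
    suc k * (2 ^ X + 1)              ≤⟨ *-mono-≤ (n<2^n k) (+-monoʳ-≤ (2 ^ X) (m^n>0 2 X)) ⟩
    2 ^ k * (2 ^ X + 2 ^ X)          ≡⟨ cong (λ e → 2 ^ k * (2 ^ X + e)) (+-identityʳ (2 ^ X)) ⟨
    2 ^ k * 2 ^ suc X                ≡⟨ ^-distribˡ-+-* 2 k (suc X) ⟨
    2 ^ (k + suc X)                  ≤⟨ ^-monoʳ-≤ 2 exponent ⟩
    2 ^ (2 * E)                      ≡⟨ *-identityʳ _ ⟨
    2 ^ (2 * E) * 1                  ≤⟨ *-monoʳ-≤ (2 ^ (2 * E)) (∸-monoˡ-≤ 1 (^-monoʳ-≤ 2 {1} {2 + m} (s≤s z≤n))) ⟩
    mainTerm (2 + m)                 ∎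
  where
  open ≤-Reasoning
  E X : ℕ
  E = 2 ^ m
  X = (2 + m) + (2 + m) + E
  error≡2^X : bonferroniError m ≡ 2 ^ X
  error≡2^X = sym (trans (^-distribˡ-+-* 2 ((2 + m) + (2 + m)) E)
                         (cong (_* 2 ^ E) (^-distribˡ-+-* 2 (2 + m) (2 + m))))
  exponent : k + suc X ≤ 2 * E
  exponent = begin
      k + suc X                 ≡⟨ solve 3 (λ k m E → k :+ (con 1 :+ ((con 2 :+ m) :+ (con 2 :+ m) :+ E))
                                                      := ((con 5 :+ k) :+ (m :+ m)) :+ E) refl k m E ⟩
      (5 + k) + (m + m) + E     ≤⟨ +-monoˡ-≤ E (+-monoˡ-≤ (m + m) 5+k≤m) ⟩
      m + (m + m) + E           ≤⟨ +-monoˡ-≤ E (m≤m+n _ m) ⟩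
      m + (m + m) + m + E       ≡⟨ cong (_+ E) (solve 1 (λ m → m :+ (m :+ m) :+ m := con 4 :* m) refl m) ⟩
      4 * m + E                 ≤⟨ +-monoˡ-≤ E (4*n≤2^n (≤⇒≤′ (≤-trans (m≤m+n 4 (suc k)) 5+k≤m))) ⟩
      E + E                     ≡⟨ cong (E +_) (+-identityʳ E) ⟨
      2 * E                     ∎
    where open +-*-Solver

∣m-n∣≤o : ∀ {m n o} → m ≤ n + o → n ≤ m + o → ∣ m - n ∣ ≤ o
∣m-n∣≤o {m} {n} m≤n+o n≤m+o with ∣m-n∣≡[m∸n]∨[n∸m] m n
... | inj₁ ∣m-n∣≡m∸n = subst (_≤ _) (sym ∣m-n∣≡m∸n) (m≤n+o⇒m∸n≤o m n m≤n+o)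
... | inj₂ ∣m-n∣≡n∸m = subst (_≤ _) (sym ∣m-n∣≡n∸m) (m≤n+o⇒m∸n≤o n m n≤m+o)

theorem4p1 : (k : ℕ) → ∃[ N ] ((n : ℕ) → N ≤ n → suc k * ∣ card-ℋ n - mainTerm n ∣ ≤ mainTerm n)
theorem4p1 k = 7 + k , bound
  where
  bound : (n : ℕ) → 7 + k ≤ n → suc k * ∣ card-ℋ n - mainTerm n ∣ ≤ mainTerm n
  bound (suc (suc m)) (s≤s (s≤s 5+k≤m)) = begin
      suc k * ∣ card-ℋ (2 + m) - mainTerm (2 + m) ∣ ≤⟨ *-monoʳ-≤ (suc k) (∣m-n∣≤o upper lower) ⟩
      suc k * (bonferroniError m + 1)                ≤⟨ bonferroniError-negligible k m 5+k≤m ⟩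
      mainTerm (2 + m)                               ∎
    where
    open ≤-Reasoning
    upper : card-ℋ (2 + m) ≤ mainTerm (2 + m) + (bonferroniError m + 1)
    upper = ≤-trans (card-ℋ-upper (suc m)) (+-monoʳ-≤ (mainTerm (2 + m)) (m≤n+m 1 (bonferroniError m)))
    lower : mainTerm (2 + m) ≤ card-ℋ (2 + m) + (bonferroniError m + 1)
    lower = ≤-trans (card-ℋ-lower m) (+-monoʳ-≤ (card-ℋ (2 + m)) (m≤m+n (bonferroniError m) 1))
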